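{- For any connected graph $G$, $pd_s(G)\ge \omega(G_{SR})$.
   Context: All graphs are finite, simple and connected; $d_G$ is the shortest-path distance and $d_G(x,W)=\min\{d_G(x,w):w\in W\}$. A set $W$ of vertices strongly resolves two different vertices $x,y\notin W$ if $d_G(x,W)=d_G(x,y)+d_G(y,W)$ or $d_G(y,W)=d_G(y,x)+d_G(x,W)$. An ordered vertex partition $\Pi$ of $G$ is a strong resolving partition if every two different vertices in the same set of $\Pi$ are strongly resolved by some set of $\Pi$; $pd_s(G)$ is the minimum cardinality of a strong resolving partition. A vertex $u$ is maximally distant from $v$ if $d_G(v,w)\le d_G(u,v)$ for every neighbor $w$ of $u$; $u,v$ are mutually maximally distant if each is maximally distant from the other. The boundary $\partial(G)$ is the set of vertices $u$ for which some $v$ exists with $u,v$ mutually maximally distant. The strong resolving graph $G_{SR}$ has vertex set $\partial(G)$, two vertices being adjacent iff they are mutually maximally distant in $G$. $\omega(H)$ is the clique number of $H$. -}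

module Defs where

open import Data.Nat using (ℕ; zero; suc; _+_; _≤_)
open import Data.Fin using (Fin)
open import Data.Product using (Σ; ∃; _×_; _,_)
open import Data.Sum using (_⊎_)
open import Relation.Nullary using (¬_)
open import Relation.Binary.PropositionalEquality using (_≡_; _≢_)
open import Function.Definitions using (Injective; Surjective)

record Graph (n : ℕ) : Set₁ where
  field
    Adj     : Fin n → Fin n → Set
    sym     : ∀ {x y} → Adj x y → Adj y x
    irrefl  : ∀ {x} → ¬ Adj x x
open Graph public

module _ {n : ℕ} (G : Graph n) where

  data Walk : Fin n → Fin n → ℕ → Set where
    nil  : ∀ {x} → Walk x x 0
    cons : ∀ {x y z k} → Adj G x y → Walk y z k → Walk x z (suc k)

  Connected : Set
  Connected = ∀ x y → ∃ λ k → Walk x y k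

  IsDist : Fin n → Fin n → ℕ → Set
  IsDist x y k = Walk x y k × (∀ j → Walk x y j → k ≤ j)

  VSet : Set₁
  VSet = Fin n → Set

  IsDistSet : Fin n → VSet → ℕ → Set
  IsDistSet x W a =
    (∃ λ w → W w × IsDist x w a) ×
    (∀ w b → W w → IsDist x w b → a ≤ b)

  StronglyResolves : VSet → Fin n → Fin n → Set
  StronglyResolves W x y =
    x ≢ y × ¬ W x × ¬ W y ×
    (∃ λ a → ∃ λ b → ∃ λ c →
      IsDistSet x W a × IsDistSet y W b × IsDist x y c ×
      (a ≡ c + b ⊎ b ≡ c + a))

  -- ordered partition into k (nonempty) sets S_0,…,S_{k-1}: S_i = f ⁻¹ i
  Part : ∀ {k} → (Fin n → Fin k) → Fin k → VSet
  Part f i v = f v ≡ i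

  IsStrongResolvingPartition : ∀ {k} → (Fin n → Fin k) → Set
  IsStrongResolvingPartition {k} f =
    Surjective _≡_ _≡_ f ×
    (∀ x y → f x ≡ f y → x ≢ y → ∃ λ j → StronglyResolves (Part f j) x y)

  MaxDistFrom : Fin n → Fin n → Set
  MaxDistFrom u v =
    ∀ w → Adj G u w → ∀ a b → IsDist v w a → IsDist u v b → a ≤ b

  MutMaxDist : Fin n → Fin n → Set
  MutMaxDist u v = MaxDistFrom u v × MaxDistFrom v u

  Boundary : Fin n → Set
  Boundary u = ∃ λ v → MutMaxDist u v

  AdjSR : Fin n → Fin n → Set
  AdjSR u v = Boundary u × Boundary v × u ≢ v × MutMaxDist u v

  -- a clique of size m in G_SR, given as an injective listing of its vertices
  IsCliqueSR : ∀ {m} → (Fin m → Fin n) → Set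
  IsCliqueSR {m} g =
    Injective _≡_ _≡_ g ×
    (∀ i → Boundary (g i)) ×
    (∀ i j → i ≢ j → AdjSR (g i) (g j))

module Submission where

-- The heart of the proof is the observation that no vertex set W can
-- strongly resolve two mutually maximally distant vertices u, v.  Suppose
-- d(u,W) = d(u,v) + d(v,W) with v ∉ W.  A shortest walk from v to W leaves v
-- through some neighbour v'; since v is maximally distant from u we have
-- d(u,v') ≤ d(u,v), so going u ⇝ v' ⇝ W gives d(u,W) < d(u,v) + d(v,W).
--
-- Consequently, in a strong resolving partition f, two vertices of a clique
-- of G_SR can never share a part (their part would have to resolve them), so
-- f restricted to the clique is injective and the clique has at most as many
-- vertices as f has parts.
--
-- Adjacency is an arbitrary relation, so the existence of a shortest walk is
-- only available under double negation; every conclusion we draw from it is a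
-- decidable inequality of naturals, which makes this harmless.

open import Defs
open import Data.Nat using (ℕ; suc; _+_; _≤_; _<_; _≤?_; _<?_)
open import Data.Nat.Properties
  using (≮⇒≥; ≤-trans; +-monoˡ-≤; <-irrefl; n<1+n; +-monoʳ-<; module ≤-Reasoning)
open import Data.Fin using (Fin; _≟_)
open import Data.Fin.Properties using (injective⇒≤)
open import Data.Product using (∃; _×_; _,_; proj₁; proj₂)
open import Data.Sum using (inj₁; inj₂)
open import Data.Empty using (⊥-elim)
open import Function using (_∘_)
open import Function.Definitions using (Injective)
open import Relation.Nullary using (¬_; yes; no)
open import Relation.Nullary.Decidable using (decidable-stable)
open import Relation.Nullary.Decidable.Core using (¬¬-excluded-middle)
open import Relation.Binary.PropositionalEquality using (_≡_; refl)
open import Induction.WellFounded using (Acc; acc)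
open import Data.Nat.Induction using (<-wellFounded)

module Walks {n : ℕ} (G : Graph n) where

  snoc : ∀ {x y z k} → Walk G x y k → Adj G y z → Walk G x z (suc k)
  snoc nil       y~z = cons y~z nil
  snoc (cons e p) y~z = cons e (snoc p y~z)

  reverse : ∀ {x y k} → Walk G x y k → Walk G y x k
  reverse nil        = nil
  reverse (cons e p) = snoc (reverse p) (Graph.sym G e)

  _++_ : ∀ {x y z i j} → Walk G x y i → Walk G y z j → Walk G x z (i + j)
  nil      ++ q = q
  cons e p ++ q = cons e (p ++ q)

  dist-sym : ∀ {x y c} → IsDist G x y c → IsDist G y x c
  dist-sym (p , minimal) = reverse p , λ j q → minimal j (reverse q)

  -- If x and y are joined by a walk, then (not not) they have a distance:
  -- by well-founded induction on the length of the walk, either some walk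
  -- is strictly shorter, or the current one is shortest.
  distance-exists : ∀ {x y L} → Walk G x y L → ¬ ¬ ∃ (IsDist G x y)
  distance-exists p = go _ (<-wellFounded _) p
    where
    go : ∀ {x y} L → Acc _<_ L → Walk G x y L → ¬ ¬ ∃ (IsDist G x y)
    go {x} {y} L (acc shorter) p noDist =
      ¬¬-excluded-middle {A = ∃ λ j → j < L × Walk G x y j} λ
        { (yes (j , j<L , q)) → go j (shorter j<L) q noDist
        ; (no none) → noDist (L , p , λ j q → ≮⇒≥ λ j<L → none (j , j<L , q)) }

  dist-bound⇒walk-bound : ∀ {x y a L} → (∀ d → IsDist G x y d → a ≤ d) →
                          Walk G x y L → a ≤ L
  dist-bound⇒walk-bound {a = a} {L} bound p = decidable-stable (a ≤? L) λ a≰L →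
    distance-exists p λ (d , dist) → a≰L (≤-trans (bound d dist) (proj₂ dist L p))

module MaximallyDistant {n : ℕ} (G : Graph n) where
  open Walks G

  -- If x ∉ W is maximally distant from y and x reaches W ∋ w by a walk of
  -- length a, then d(y,W) < d(y,x) + a: follow the first edge x → x' of the
  -- walk, which does not take us farther from y.
  shortcut : ∀ {W x y w a b c} → ¬ W x → W w → Walk G x w a →
             IsDist G y x c → MaxDistFrom G x y → IsDistSet G y W b →
             b < c + a
  shortcut x∉W w∈W nil _ _ _ = ⊥-elim (x∉W w∈W)
  shortcut {w = w} {suc a} {b} {c} _ w∈W (cons {y = x'} x~x' rest)
           dyx maxDist (_ , closest) =
    decidable-stable (b <? c + suc a) λ b≮ →
      distance-exists (snoc (proj₁ dyx) x~x') λ (e , dyx') →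
        let e≤c : e ≤ c
            e≤c = maxDist x' x~x' e c dyx' (dist-sym dyx)
            b≤e+a : b ≤ e + a
            b≤e+a = dist-bound⇒walk-bound (λ d dyw → closest w d w∈W dyw)
                                          (proj₁ dyx' ++ rest)
            open ≤-Reasoning
        in b≮ (begin-strict
             b         ≤⟨ b≤e+a ⟩
             e + a     ≤⟨ +-monoˡ-≤ a e≤c ⟩
             c + a     <⟨ +-monoʳ-< c (n<1+n a) ⟩
             c + suc a ∎)

  not-resolved-through : ∀ {W x y a b c} → ¬ W x → IsDistSet G x W a →
                         IsDistSet G y W b → IsDist G y x c →
                         MaxDistFrom G x y → ¬ (b ≡ c + a)
  not-resolved-through x∉W ((w , w∈W , (xw , _)) , _) dyW dyx maxDist refl =
    <-irrefl refl (shortcut x∉W w∈W xw dyx maxDist dyW)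

  mutMaxDist⇒¬resolved : ∀ {W u v} → MutMaxDist G u v → ¬ StronglyResolves G W u v
  mutMaxDist⇒¬resolved (_ , v-max)
                       (_ , _ , v∉W , _ , _ , _ , duW , dvW , duv , inj₁ eq) =
    not-resolved-through v∉W dvW duW duv v-max eq
  mutMaxDist⇒¬resolved (u-max , _)
                       (_ , u∉W , _ , _ , _ , _ , duW , dvW , duv , inj₂ eq) =
    not-resolved-through u∉W duW dvW (dist-sym duv) u-max eq

  clique-parts-distinct : ∀ {k m} {f : Fin n → Fin k} {g : Fin m → Fin n} →
                          IsStrongResolvingPartition G f → IsCliqueSR G g →
                          Injective _≡_ _≡_ (f ∘ g)
  clique-parts-distinct (_ , resolved) (_ , _ , adjacent) {i} {j} samePart =
    decidable-stable (i ≟ j) λ i≢j →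
      let (_ , _ , gi≢gj , mmd) = adjacent i j i≢j
          (_ , resolves)        = resolved _ _ samePart gi≢gj
      in mutMaxDist⇒¬resolved mmd resolves

corollary6 : (n : ℕ) (G : Graph n) → Connected G →
    (k : ℕ) (f : Fin n → Fin k) → IsStrongResolvingPartition G f →
    (m : ℕ) (g : Fin m → Fin n) → IsCliqueSR G g →
    m ≤ k
corollary6 n G _ k f partition m g clique =
  injective⇒≤ (MaximallyDistant.clique-parts-distinct G partition clique)
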